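{- Let $b\ge2$, $s\ge1$ and $r$ be integers and let $F(x)=\frac{x}{b}+\frac{r}{s}$. Let $u/v$ be a rational number with $u/v\neq\frac{br}{(b-1)s}$ (the fixed point of $F$). Then for every integer $t\ge0$ there is $N_0(t)$ such that for all integers $N\ge N_0(t)$ the rational number $F^N(u/v)$, written in lowest terms, has denominator divisible by $b^t$.
   Context: $F^N$ denotes the $N$-fold composition of $F$. -}

module Defs where

open import Data.Nat as ℕ using (ℕ; zero; suc; NonZero; _∸_; _≤_; s≤s; z≤n)
open import Data.Integer as ℤ using (ℤ; +_)
open import Data.Rational as ℚ using (ℚ)

_^[_] : {A : Set} → (A → A) → ℕ → A → A
(f ^[ zero ]) x = x
(f ^[ suc n ]) x = f ((f ^[ n ]) x)

F : (b s : ℕ) .{{_ : NonZero b}} .{{_ : NonZero s}} → ℤ → ℚ → ℚ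
F b s r x = x ℚ.* (+ 1 ℚ./ b) ℚ.+ (r ℚ./ s)

fixedPoint : (b s : ℕ) → 2 ≤ b → 1 ≤ s → ℤ → ℚ
fixedPoint (suc (suc b')) (suc s') (s≤s (s≤s z≤n)) (s≤s z≤n) r =
  ((+ (suc (suc b'))) ℤ.* r) ℚ./ ((suc b') ℕ.* (suc s'))

{-# OPTIONS --safe #-}
module Submission where

-- Write x = u/v and c₀ = b r v, W = v (b − 1) s, p = u (b − 1) s − c₀, so that the fixed point is
-- c₀/W and x − c₀/W = p/W. Since F contracts towards its fixed point by the factor b,
-- Fⁿ(x) = (bⁿ c₀ + p)/(W bⁿ); hence if a/d is Fⁿ(x) in lowest terms then d p = bⁿ (a W − c₀ d),
-- i.e. bⁿ divides d |p|, and p ≠ 0 because x is not the fixed point. A fixed k = |p| ≥ 1 can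
-- only absorb |p| powers of b: if g = gcd(k, b) > 1, cancelling g against one factor b costs one
-- power of b and replaces k by k/g < k, and once k is coprime to b it absorbs none.

open import Defs
open import Data.Nat using (ℕ; NonZero; _≤_; _^_)
open import Data.Nat.Divisibility using (_∣_)
open import Data.Integer using (ℤ)
open import Data.Rational using (ℚ; ↧ₙ_)
open import Data.Product using (∃-syntax)
open import Relation.Binary.PropositionalEquality using (_≢_)

open import Data.Nat.Base using (zero; suc; s≤s; z≤n)
import Data.Nat.Base as ℕ
open import Data.Nat.Induction using (<-wellFounded)
open import Data.Nat.Properties using (n≢0⇒n>0)
open import Data.Integer.Base using (∣_∣)
open import Data.Integer.Properties using (∣i∣≡0⇒i≡0)
open import Data.Product using (_,_)
open import Function using (_∘_)

module PowerDivisibility where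
  open import Data.Nat.Base using (_+_; _*_; _<_; ≢-nonZero)
  open import Data.Nat.Properties
    using (*-comm; *-assoc; m<m*n; ≤∧≢⇒<; ≤-trans; ≤-pred; m≤n+m; +-monoˡ-≤; _≟_)
  open import Data.Nat.Divisibility
    using (divides; ∣-trans; 1∣_; m∣m*n; n∣m*n; *-monoʳ-∣; *-cancelˡ-∣; *-cancelʳ-∣)
  open import Data.Nat.GCD using (gcd; gcd[m,n]∣m; gcd[m,n]∣n; gcd[m,n]≢0)
  open import Data.Nat.Coprimality as Coprimality using (Coprime; coprime-divisor; gcd≡1⇒coprime)
  open import Data.Sum using (inj₁)
  open import Induction.WellFounded using (Acc; acc)
  open import Relation.Binary.PropositionalEquality
    using (_≡_; refl; sym; trans; cong; subst; subst₂)
  open import Relation.Nullary using (yes; no)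

  ^-monoʳ-∣ : ∀ b {m n} → m ≤ n → b ^ m ∣ b ^ n
  ^-monoʳ-∣ b z≤n       = 1∣ _
  ^-monoʳ-∣ b (s≤s m≤n) = *-monoʳ-∣ b (^-monoʳ-∣ b m≤n)

  ^-∣-coprime-cancelʳ : ∀ {b k} .{{_ : NonZero b}} → Coprime b k →
                        ∀ n {d} → b ^ n ∣ d * k → b ^ n ∣ d
  ^-∣-coprime-cancelʳ c zero _ = 1∣ _
  ^-∣-coprime-cancelʳ {b} {k} c (suc n) {d} bⁿ⁺¹∣dk
    with divides q refl ← coprime-divisor c
                             (∣-trans (m∣m*n (b ^ n)) (subst (b ^ suc n ∣_) (*-comm d k) bⁿ⁺¹∣dk))
    = subst (b ^ suc n ∣_) (*-comm b q)
        (*-monoʳ-∣ b (^-∣-coprime-cancelʳ c n (*-cancelˡ-∣ b (subst (b ^ suc n ∣_) qbk≡b[qk] bⁿ⁺¹∣dk))))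
    where
    qbk≡b[qk] : q * b * k ≡ b * (q * k)
    qbk≡b[qk] = trans (cong (_* k) (*-comm q b)) (*-assoc b q k)

  ^-∣-cancel-common-factor : ∀ {b k′ g d} n .{{_ : NonZero g}} →
                             g ∣ b → b ^ suc n ∣ d * (k′ * g) → b ^ n ∣ d * k′
  ^-∣-cancel-common-factor {k′ = k′} {g} {d} n (divides b′ refl) bⁿ⁺¹∣dk =
    ∣-trans (n∣m*n b′) (*-cancelʳ-∣ g (subst₂ _∣_ regroup (sym (*-assoc d k′ g)) bⁿ⁺¹∣dk))
    where
    regroup : b′ * g * (b′ * g) ^ n ≡ b′ * (b′ * g) ^ n * g
    regroup = trans (*-assoc b′ g _) (trans (cong (b′ *_) (*-comm g _)) (sym (*-assoc b′ _ g)))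

  ^-∣-cancelʳ : ∀ {b} .{{_ : NonZero b}} {k} → Acc _<_ k → 1 ≤ k →
                ∀ {t n d} → k + t ≤ n → b ^ n ∣ d * k → b ^ t ∣ d
  ^-∣-cancelʳ {b} {k} (acc rec) (s≤s z≤n) {t} {suc n} {d} k+t≤1+n bⁿ∣dk with gcd k b ≟ 1
  ... | yes gcd≡1 = ∣-trans (^-monoʳ-∣ b (≤-trans (m≤n+m t k) k+t≤1+n))
                      (^-∣-coprime-cancelʳ (Coprimality.sym (gcd≡1⇒coprime gcd≡1)) (suc n) bⁿ∣dk)
  ... | no gcd≢1
    with divides k′ k≡k′g ← gcd[m,n]∣m k b
    = ^-∣-cancelʳ (rec k′<k) (n≢0⇒n>0 k′≢0) k′+t≤n
        (^-∣-cancel-common-factor {k′ = k′} {g} {d} n (gcd[m,n]∣n k b)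
          (subst (λ k → b ^ suc n ∣ d * k) k≡k′g bⁿ∣dk))
    where
    g = gcd k b
    g≢0 : g ≢ 0
    g≢0 = gcd[m,n]≢0 k b (inj₁ λ ())
    instance
      g-nonZero : NonZero g
      g-nonZero = ≢-nonZero g≢0
    k′≢0 : k′ ≢ 0
    k′≢0 k′≡0 with () ← trans k≡k′g (cong (_* g) k′≡0)
    k′<k : k′ < k
    k′<k = subst (k′ <_) (sym k≡k′g)
             (m<m*n k′ g ⦃ ≢-nonZero k′≢0 ⦄ (≤∧≢⇒< (n≢0⇒n>0 g≢0) (λ 1≡g → gcd≢1 (sym 1≡g))))
    k′+t≤n : k′ + t ≤ n
    k′+t≤n = ≤-pred (≤-trans (+-monoˡ-≤ t k′<k) k+t≤1+n)

module Fraction where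
  open import Data.Integer.Base using (+_; _+_; _-_; _*_)
  import Data.Integer.Base as ℤ
  open import Data.Integer.Properties
    using (*-assoc; *-identityʳ; *-cancelʳ-≡; abs-*; *-commutativeSemigroup)
  open import Algebra.Properties.CommutativeSemigroup *-commutativeSemigroup
    using (interchange; xy∙z≈xz∙y; x∙yz≈xz∙y)
  open import Data.Integer.GCD using (gcd)
  open import Data.Integer.Tactic.RingSolver using (solve-∀)
  open import Data.Nat.Divisibility using (divides)
  import Data.Nat.Properties as ℕ
  open import Data.Rational.Base using (mkℚ; ↥_; ↧_; _/_; toℚᵘ)
  import Data.Rational.Base as ℚ
  open import Data.Rational.Properties using (↥-/; ↧-/; toℚᵘ-homo-+; toℚᵘ-homo-*)
  open import Data.Rational.Unnormalised.Base as ℚᵘ using (ℚᵘ; mkℚᵘ; *≡*; _≃_)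
    renaming (↥_ to ↥ᵘ_; ↧_ to ↧ᵘ_)
  open import Data.Rational.Unnormalised.Properties using (≃-trans; +-congˡ)
  open import Relation.Binary.PropositionalEquality
    using (_≡_; cong; cong₂; subst; module ≡-Reasoning)
  open ≡-Reasoning

  record HasFraction (z : ℚᵘ) (a q : ℤ) : Set where
    constructor fraction
    field cross-≡ : ↥ᵘ z * q ≡ a * ↧ᵘ z

  fraction-+ : ∀ z w {a q c r} → HasFraction z a q → HasFraction w c r →
               HasFraction (z ℚᵘ.+ w) (a * r + c * q) (q * r)
  fraction-+ z@(mkℚᵘ _ _) w@(mkℚᵘ _ _) {a} {q} {c} {r} (fraction z≈a/q) (fraction w≈c/r) =
    fraction (begin
    (↥ᵘ z * ↧ᵘ w + ↥ᵘ w * ↧ᵘ z) * (q * r)               ≡⟨ expand (↥ᵘ z) (↧ᵘ w) (↥ᵘ w) (↧ᵘ z) q r ⟩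
    (↥ᵘ z * q) * (↧ᵘ w * r) + (↥ᵘ w * r) * (↧ᵘ z * q)
      ≡⟨ cong₂ (λ x y → x * (↧ᵘ w * r) + y * (↧ᵘ z * q)) z≈a/q w≈c/r ⟩
    (a * ↧ᵘ z) * (↧ᵘ w * r) + (c * ↧ᵘ w) * (↧ᵘ z * q)   ≡⟨ collect a (↧ᵘ z) (↧ᵘ w) r c q ⟩
    (a * r + c * q) * (↧ᵘ z * ↧ᵘ w)                     ∎)
    where
    expand : ∀ x d y e q r → (x * d + y * e) * (q * r) ≡ (x * q) * (d * r) + (y * r) * (e * q)
    expand = solve-∀
    collect : ∀ a e d r c q → (a * e) * (d * r) + (c * d) * (e * q) ≡ (a * r + c * q) * (e * d)
    collect = solve-∀

  fraction-* : ∀ z w {a q c r} → HasFraction z a q → HasFraction w c r →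
               HasFraction (z ℚᵘ.* w) (a * c) (q * r)
  fraction-* z@(mkℚᵘ _ _) w@(mkℚᵘ _ _) {a} {q} {c} {r} (fraction z≈a/q) (fraction w≈c/r) =
    fraction (begin
    (↥ᵘ z * ↥ᵘ w) * (q * r)     ≡⟨ interchange (↥ᵘ z) (↥ᵘ w) q r ⟩
    (↥ᵘ z * q) * (↥ᵘ w * r)     ≡⟨ cong₂ _*_ z≈a/q w≈c/r ⟩
    (a * ↧ᵘ z) * (c * ↧ᵘ w)     ≡⟨ interchange a (↧ᵘ z) c (↧ᵘ w) ⟩
    (a * c) * (↧ᵘ z * ↧ᵘ w)     ∎)

  fraction-resp-≃ : ∀ {z w a q} → z ≃ w → HasFraction w a q → HasFraction z a q
  fraction-resp-≃ {z@(mkℚᵘ x _)} {w@(mkℚᵘ y _)} {a} {q} (*≡* z≃w) (fraction w≈a/q) =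
    fraction (*-cancelʳ-≡ _ _ (↧ᵘ w) (begin
      (x * q) * ↧ᵘ w         ≡⟨ xy∙z≈xz∙y x q (↧ᵘ w) ⟩
      (x * ↧ᵘ w) * q         ≡⟨ cong (_* q) z≃w ⟩
      (y * ↧ᵘ z) * q         ≡⟨ xy∙z≈xz∙y y (↧ᵘ z) q ⟩
      (y * q) * ↧ᵘ z         ≡⟨ cong (_* ↧ᵘ z) w≈a/q ⟩
      (a * ↧ᵘ w) * ↧ᵘ z      ≡⟨ xy∙z≈xz∙y a (↧ᵘ w) (↧ᵘ z) ⟩
      (a * ↧ᵘ z) * ↧ᵘ w      ∎))

  fraction-cancelʳ : ∀ {z a q} k .{{_ : ℤ.NonZero k}} →
                     HasFraction z (a * k) (q * k) → HasFraction z a q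
  fraction-cancelʳ {z} {a} {q} k (fraction z≈ak/qk) = fraction (*-cancelʳ-≡ _ _ k (begin
    (↥ᵘ z * q) * k     ≡⟨ *-assoc (↥ᵘ z) q k ⟩
    ↥ᵘ z * (q * k)     ≡⟨ z≈ak/qk ⟩
    (a * k) * ↧ᵘ z     ≡⟨ xy∙z≈xz∙y a k (↧ᵘ z) ⟩
    (a * ↧ᵘ z) * k     ∎))

  fraction-unique : ∀ {z w a q} .{{_ : ℤ.NonZero q}} →
                    HasFraction z a q → HasFraction w a q → z ≃ w
  fraction-unique {z} {w} {a} {q} (fraction z≈a/q) (fraction w≈a/q) =
    *≡* (*-cancelʳ-≡ _ _ q (begin
    (↥ᵘ z * ↧ᵘ w) * q      ≡⟨ xy∙z≈xz∙y (↥ᵘ z) (↧ᵘ w) q ⟩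
    (↥ᵘ z * q) * ↧ᵘ w      ≡⟨ cong (_* ↧ᵘ w) z≈a/q ⟩
    (a * ↧ᵘ z) * ↧ᵘ w      ≡⟨ xy∙z≈xz∙y a (↧ᵘ z) (↧ᵘ w) ⟩
    (a * ↧ᵘ w) * ↧ᵘ z      ≡⟨ cong (_* ↧ᵘ z) w≈a/q ⟨
    (↥ᵘ w * q) * ↧ᵘ z      ≡⟨ xy∙z≈xz∙y (↥ᵘ w) q (↧ᵘ z) ⟩
    (↥ᵘ w * ↧ᵘ z) * q      ∎))

  fraction-toℚᵘ : ∀ {x a q} → ↥ x * q ≡ a * ↧ x → HasFraction (toℚᵘ x) a q
  fraction-toℚᵘ {mkℚ _ _ _} x≈a/q = fraction x≈a/q

  fraction-/ : ∀ i n .{{_ : ℕ.NonZero n}} → HasFraction (toℚᵘ (i / n)) i (+ n)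
  fraction-/ i n with i / n | ↥-/ i n | ↧-/ i n
  ... | mkℚ x d-1 _ | x*g≡i | d*g≡n = fraction (begin
    x * + n                   ≡⟨ cong (x *_) d*g≡n ⟨
    x * (+ suc d-1 * g)       ≡⟨ x∙yz≈xz∙y x (+ suc d-1) g ⟩
    (x * g) * + suc d-1       ≡⟨ cong (_* + suc d-1) x*g≡i ⟩
    i * + suc d-1             ∎)
    where
    g = gcd i (+ n)

  fraction-denominator-∣ : ∀ {z P c p W} →
    HasFraction (toℚᵘ z) (+ P * c + p) (W * + P) → P ∣ ↧ₙ z ℕ.* ∣ p ∣
  fraction-denominator-∣ {z@(mkℚ _ _ _)} {P} {c} {p} {W} (fraction z≈[Pc+p]/WP) =
    divides ∣ X ∣ (begin
    ↧ₙ z ℕ.* ∣ p ∣     ≡⟨ abs-* (↧ z) p ⟨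
    ∣ ↧ z * p ∣        ≡⟨ cong ∣_∣ ↧z*p≡P*X ⟩
    ∣ + P * X ∣        ≡⟨ abs-* (+ P) X ⟩
    P ℕ.* ∣ X ∣        ≡⟨ ℕ.*-comm P ∣ X ∣ ⟩
    ∣ X ∣ ℕ.* P        ∎)
    where
    X = ↥ z * W - c * ↧ z
    ↧z*p≡P*X : ↧ z * p ≡ + P * X
    ↧z*p≡P*X = begin
      ↧ z * p                                   ≡⟨ isolate (↧ z) p (+ P) c ⟩
      (+ P * c + p) * ↧ z - + P * c * ↧ z       ≡⟨ cong (_- + P * c * ↧ z) z≈[Pc+p]/WP ⟨
      ↥ z * (W * + P) - + P * c * ↧ z           ≡⟨ factor (↥ z) W (+ P) c (↧ z) ⟩
      + P * X                                   ∎
      where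
      isolate : ∀ d p P c → d * p ≡ (P * c + p) * d - P * c * d
      isolate = solve-∀
      factor : ∀ a W P c d → a * (W * P) - P * c * d ≡ P * (a * W - c * d)
      factor = solve-∀

  F-fraction : ∀ b s .{{_ : ℕ.NonZero b}} .{{_ : ℕ.NonZero s}} r {x a q} →
               HasFraction (toℚᵘ x) a q →
               HasFraction (toℚᵘ (F b s r x)) (a * + s + r * (q * + b)) (q * + b * + s)
  F-fraction b s r {x} {a} {q} x≈a/q =
    fraction-resp-≃ F-toℚᵘ
      (fraction-+ (toℚᵘ x ℚᵘ.* toℚᵘ b⁻¹) (toℚᵘ r/s)
        (subst (λ a′ → HasFraction (toℚᵘ x ℚᵘ.* toℚᵘ b⁻¹) a′ (q * + b)) (*-identityʳ a)
          (fraction-* (toℚᵘ x) (toℚᵘ b⁻¹) x≈a/q (fraction-/ (+ 1) b)))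
        (fraction-/ r s))
    where
    b⁻¹ r/s : ℚ
    b⁻¹ = + 1 / b
    r/s = r / s
    F-toℚᵘ : toℚᵘ (F b s r x) ≃ toℚᵘ x ℚᵘ.* toℚᵘ b⁻¹ ℚᵘ.+ toℚᵘ r/s
    F-toℚᵘ = ≃-trans (toℚᵘ-homo-+ (x ℚ.* b⁻¹) r/s) (+-congˡ (toℚᵘ r/s) (toℚᵘ-homo-* x b⁻¹))

module Orbit (m s : ℕ) .{{_ : NonZero m}} .{{_ : NonZero s}} (r : ℤ) (x : ℚ) where
  open import Data.Integer.Base using (+_; _+_; _-_; _*_; 1ℤ; 0ℤ)
  open import Data.Integer.Properties using (*-assoc; pos-*; i-j≡0⇒i≡j)
  open import Data.Integer.Tactic.RingSolver using (solve-∀)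
  open import Data.Nat.Properties using (m*n≢0)
  open import Data.Rational.Base using (↥_; ↧_; _/_; toℚᵘ)
  open import Data.Rational.Properties using (toℚᵘ-injective)
  open import Relation.Binary.PropositionalEquality
    using (_≡_; sym; cong; subst; subst₂; module ≡-Reasoning)
  open ≡-Reasoning
  open Fraction

  b : ℕ
  b = suc m

  c₀ W p : ℤ
  c₀ = + b * r * ↧ x
  W  = ↧ x * + m * + s
  p  = ↥ x * + m * + s - c₀

  iterate : ℕ → ℚ
  iterate n = (F b s r ^[ n ]) x

  -- The ring identities below write + b as 1ℤ + m, to which it computes.
  orbit-fraction : ∀ n → HasFraction (toℚᵘ (iterate n)) (+ (b ^ n) * c₀ + p) (W * + (b ^ n))
  orbit-fraction zero = fraction-toℚᵘ (initial (↥ x) (↧ x) (+ m) (+ s) r)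
    where
    initial : ∀ u v m s r →
      u * (v * m * s * 1ℤ) ≡ (1ℤ * ((1ℤ + m) * r * v) + (u * m * s - (1ℤ + m) * r * v)) * v
    initial = solve-∀
  orbit-fraction (suc n) =
    subst (λ P → HasFraction (toℚᵘ (iterate (suc n))) (P * c₀ + p) (W * P)) (sym (pos-* b (b ^ n)))
      (fraction-cancelʳ (+ s)
        (subst₂ (HasFraction (toℚᵘ (iterate (suc n))))
          (numerator (↥ x) (↧ x) (+ m) (+ s) r (+ (b ^ n)))
          (denominator W (+ b) (+ (b ^ n)) (+ s))
          (F-fraction b s r (orbit-fraction n))))
    where
    numerator : ∀ u v m s r P →
      (P * ((1ℤ + m) * r * v) + (u * m * s - (1ℤ + m) * r * v)) * s + r * (v * m * s * P * (1ℤ + m))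
      ≡ ((1ℤ + m) * P * ((1ℤ + m) * r * v) + (u * m * s - (1ℤ + m) * r * v)) * s
    numerator = solve-∀
    denominator : ∀ W b P s → W * P * b * s ≡ W * (b * P) * s
    denominator = solve-∀

  orbit-denominator : ∀ n → b ^ n ∣ ↧ₙ iterate n ℕ.* ∣ p ∣
  orbit-denominator n = fraction-denominator-∣ {W = W} (orbit-fraction n)

  instance
    m*s≢0 : NonZero (m ℕ.* s)
    m*s≢0 = m*n≢0 m s

  p≡0⇒fixed : p ≡ 0ℤ → x ≡ (+ b * r) / (m ℕ.* s)
  p≡0⇒fixed p≡0 = toℚᵘ-injective (fraction-unique x≈br/ms (fraction-/ (+ b * r) (m ℕ.* s)))
    where
    x≈br/ms : HasFraction (toℚᵘ x) (+ b * r) (+ (m ℕ.* s))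
    x≈br/ms = fraction-toℚᵘ (begin
      ↥ x * + (m ℕ.* s)      ≡⟨ cong (↥ x *_) (pos-* m s) ⟩
      ↥ x * (+ m * + s)      ≡⟨ *-assoc (↥ x) (+ m) (+ s) ⟨
      ↥ x * + m * + s        ≡⟨ i-j≡0⇒i≡j _ _ p≡0 ⟩
      + b * r * ↧ x          ∎)

proposition2 : (b s : ℕ) .{{_ : NonZero b}} .{{_ : NonZero s}} (r : ℤ) →
    (hb : 2 ≤ b) (hs : 1 ≤ s) (x : ℚ) →
    x ≢ fixedPoint b s hb hs r →
    (t : ℕ) → ∃[ N₀ ] ((N : ℕ) → N₀ ≤ N → (b ^ t) ∣ ↧ₙ ((F b s r ^[ N ]) x))
proposition2 (suc (suc b′)) (suc s′) r (s≤s (s≤s z≤n)) (s≤s z≤n) x x≢fixed t =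
  K ℕ.+ t , λ N K+t≤N → ^-∣-cancelʳ (<-wellFounded K) 1≤K K+t≤N (orbit-denominator N)
  where
  open PowerDivisibility using (^-∣-cancelʳ)
  open Orbit (suc b′) (suc s′) r x
  K = ∣ p ∣
  1≤K : 1 ≤ K
  1≤K = n≢0⇒n>0 (x≢fixed ∘ p≡0⇒fixed ∘ ∣i∣≡0⇒i≡0)
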